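{- Let $P$ and $Q$ be lattice paths from $(0,0)$ to $(m,r)$, $n=m+r$, with $P$ never above $Q$ and meeting $Q$ only at $(0,0)$ and $(m,r)$, so that $M=M[P,Q]$ is a connected lattice path matroid on $[n]$ with path presentation $(N_1,\ldots,N_r)$. Let $A=[a]$ be an initial connected flat and $B=[b,n]$ a final connected flat of $M$. Then $(A,B)$ is a modular pair if and only if the number of indices $i\in[r]$ for which both $A\cap N_i$ and $B\cap N_i$ are nonempty is at most $|A\cap B|$.
   Context: A lattice path is a word $p_1\cdots p_n$ in the letters $N$ (a unit step north) and $E$ (a unit step east), read as a path starting at $(0,0)$. For lattice paths $P=p_1\cdots p_n$, $Q=q_1\cdots q_n$ from $(0,0)$ to $(m,r)$ with $P$ never going above $Q$, let $p_{u_1},\ldots,p_{u_r}$ ($u_1<\cdots<u_r$) be the north steps of $P$ and $q_{l_1},\ldots,q_{l_r}$ ($l_1<\cdots<l_r$) those of $Q$, and set $N_i=[l_i,u_i]=\{l_i,l_i+1,\ldots,u_i\}$. $M[P,Q]$ is the transversal matroid on $[n]=\{1,\ldots,n\}$ whose independent sets are the partial transversals of the set system $(N_1,\ldots,N_r)$ (sets $I$ admitting an injection $\phi:I\to[r]$ with $e\in N_{\phi(e)}$); $(N_1,\ldots,N_r)$ is its path presentation. An initial connected flat of $M[P,Q]$ is an interval $[a]$ such that $q_a=E$ and $q_{a+1}=N$; a final connected flat is an interval $[b,n]$ such that $p_{b-1}=N$ and $p_b=E$. A pair $(X,Y)$ of sets is modular if $r(X)+r(Y)=r(X\cup Y)+r(X\cap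 Y)$. -}

module Defs where

open import Data.Nat using (ℕ; zero; suc; _+_; _≤_; _<_; _<ᵇ_; _≤ᵇ_)
open import Data.Bool using (Bool; true; false; _∧_)
open import Data.Fin using (Fin; toℕ)
open import Data.Vec using (Vec; []; _∷_; lookup; tabulate)
open import Data.Fin.Subset using (Subset; _∈_; _⊆_; _∩_; _∪_; ∣_∣)
open import Data.Fin.Subset.Properties using (nonempty?)
open import Data.Product using (Σ; ∃; ∃-syntax; _×_)
open import Relation.Nullary using (does)
open import Relation.Binary.PropositionalEquality using (_≡_)

-- Conventions: [n] = {1,…,n} is represented by Fin n, the element j ∈ [n]
-- corresponding to the i : Fin n with toℕ i + 1 ≡ j.  A lattice path of
-- length n is a vector of n steps; its j-th letter p_j is  lookup P i.

data Step : Set where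
  N E : Step

Path : ℕ → Set
Path n = Vec Step n

isN : Step → ℕ
isN N = 1
isN E = 0

#N : ∀ {n} → Path n → ℕ → ℕ
#N []      k       = 0
#N (s ∷ v) zero    = 0
#N (s ∷ v) (suc k) = isN s + #N v k

-- P, Q : (0,0) → (m,r):  length m + r, with r north steps
EndsAt : (m r : ℕ) → Path (m + r) → Set
EndsAt m r P = #N P (m + r) ≡ r

-- P never goes above Q (after k steps both paths lie on the line x+y = k)
NeverAbove : ∀ {n} → Path n → Path n → Set
NeverAbove {n} P Q = ∀ k → k ≤ n → #N P k ≤ #N Q k

MeetOnlyAtEnds : ∀ {n} → Path n → Path n → Set
MeetOnlyAtEnds {n} P Q = ∀ k → 0 < k → k < n → #N P k < #N Q k

-- 0-based position of the (i+1)-st north step of a path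
-- (junk value if there is no such step; never used for valid paths)
posN : ∀ {n} → Path n → ℕ → ℕ
posN []      i       = 0
posN (N ∷ v) zero    = 0
posN (N ∷ v) (suc i) = suc (posN v i)
posN (E ∷ v) i       = suc (posN v i)

-- path presentation: N_{i+1} = [l_{i+1}, u_{i+1}] (i : Fin r), where
-- l = positions of north steps of Q, u = positions of north steps of P
Nset : ∀ {n} (r : ℕ) → Path n → Path n → Fin r → Subset n
Nset r P Q i = tabulate (λ e → (posN Q (toℕ i) ≤ᵇ toℕ e) ∧ (toℕ e ≤ᵇ posN P (toℕ i)))

-- partial transversals of (N_1,…,N_r): independent sets of M[P,Q]
Independent : ∀ {n} (r : ℕ) → Path n → Path n → Subset n → Set
Independent {n} r P Q I =
  Σ ((e : Fin n) → e ∈ I → Fin r) λ φ →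
    (∀ e (h : e ∈ I) → e ∈ Nset r P Q (φ e h)) ×
    (∀ e e' (h : e ∈ I) (h' : e' ∈ I) → φ e h ≡ φ e' h' → e ≡ e')

IsRank : ∀ {n} (r : ℕ) → Path n → Path n → Subset n → ℕ → Set
IsRank r P Q X k =
  (∃[ I ] (I ⊆ X × Independent r P Q I × ∣ I ∣ ≡ k)) ×
  (∀ I → I ⊆ X → Independent r P Q I → ∣ I ∣ ≤ k)

ModularPair : ∀ {n} (r : ℕ) → Path n → Path n → Subset n → Subset n → Set
ModularPair r P Q X Y =
  ∃[ rX ] ∃[ rY ] ∃[ rU ] ∃[ rI ]
    (IsRank r P Q X rX × IsRank r P Q Y rY × IsRank r P Q (X ∪ Y) rU × IsRank r P Q (X ∩ Y) rI
     × rX + rY ≡ rU + rI)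

initSeg : ∀ {n} → ℕ → Subset n
initSeg a = tabulate (λ e → toℕ e <ᵇ a)

finalSeg : ∀ {n} → ℕ → Subset n
finalSeg b = tabulate (λ e → b ≤ᵇ suc (toℕ e))

-- [a] is an initial connected flat: q_a = E and q_{a+1} = N (1-based)
IsInitialConnectedFlat : ∀ {n} → Path n → ℕ → Set
IsInitialConnectedFlat {n} Q a =
  (∃[ j ] (toℕ {n} j + 1 ≡ a × lookup Q j ≡ E)) ×
  (∃[ j ] (toℕ {n} j ≡ a × lookup Q j ≡ N))

-- [b,n] is a final connected flat: p_{b-1} = N and p_b = E (1-based)
IsFinalConnectedFlat : ∀ {n} → Path n → ℕ → Set
IsFinalConnectedFlat {n} P b =
  (∃[ j ] (toℕ {n} j + 2 ≡ b × lookup P j ≡ N)) ×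
  (∃[ j ] (toℕ {n} j + 1 ≡ b × lookup P j ≡ E))

#meeting : ∀ {n} (r : ℕ) → Path n → Path n → Subset n → Subset n → ℕ
#meeting r P Q A B =
  ∣ tabulate {n = r} (λ i → does (nonempty? (A ∩ Nset r P Q i)) ∧ does (nonempty? (B ∩ Nset r P Q i))) ∣

{-# OPTIONS --safe #-}
-- In M[P,Q] the block N_i = [l_i, u_i] meets A = [a] iff l_i ≤ a and meets B = [b, n] iff u_i ≥ b.
-- The bottom ends l_i represent the blocks meeting A, the top ends u_i those meeting B, and a mix of
-- the two those meeting A ∪ B, all injectively; so r(A), r(B) and r(A ∪ B) count the blocks meeting
-- A, B and A ∪ B, and by inclusion–exclusion (A, B) is modular iff r(A ∩ B) is the number of blocks
-- meeting both. Since r(A ∩ B) ≤ |A ∩ B| this forces the inequality. Conversely, the blocks meeting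
-- both form an interval of indices, and when it is no longer than the interval A ∩ B they can be
-- matched greedily into A ∩ B.
module Submission where

open import Defs
open import Data.Bool using (Bool; _∧_; T)
open import Data.Bool.Properties using (T-≡; T-∧)
open import Data.Fin using (Fin; toℕ; fromℕ<; zero; suc; _≟_)
open import Data.Fin.Properties
  using (toℕ<n; toℕ-fromℕ<; toℕ-injective; fromℕ<-injective; suc-injective; 0≢1+n; any?)
open import Data.Fin.Subset using (Subset; _∈_; _⊆_; _∩_; _∪_; ∁; ∣_∣; inside; outside; _-_; ⊥; Nonempty)
open import Data.Fin.Subset.Properties
  using (_∈?_; nonempty?; x∈p∩q⁺; x∈p∩q⁻; x∈p∪q⁺; x∈p∪q⁻; x∈∁p⇒x∉p; x∉p⇒x∈∁p; x∈p∧x≢y⇒x∈p-y;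
         drop-∷-⊆; ⊆-antisym; p⊆q⇒∣p∣≤∣q∣; ∣⊥∣≡0; x∈p⇒∣p-x∣<∣p∣)
open import Data.Nat using (ℕ; zero; suc; _+_; _∸_; _⊔_; _≤_; _<_; _<?_; z≤n; s≤s; s≤s⁻¹)
open import Data.Nat.Properties
  using (≤⇒≤ᵇ; ≤ᵇ⇒≤; <⇒<ᵇ; <ᵇ⇒<; ≤-refl; ≤-reflexive; ≤-trans; ≤-antisym; ≤-total;
         <-trans; ≤-<-trans; <-≤-trans; <⇒≤; <⇒≢; <⇒≱; ≤⇒≯; ≮⇒≥; ≰⇒>; <-cmp; n≤0⇒n≡0;
         +-comm; +-assoc; +-suc; +-cancelˡ-≡; +-cancelʳ-≡; +-mono-≤; +-monoʳ-≤; +-monoʳ-<;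
         ∸-monoˡ-<; m+[n∸m]≡n; m∸n+n≡m; m≤n⇒m∸n≡0; m≤m+n; m≤m⊔n; m≤n⊔m; ⊔-lub; ⊔-pres-<m; ⊔-mono-<)
open import Data.Product using (Σ; ∃-syntax; _×_; _,_; proj₁; proj₂)
open import Data.Sum using (inj₁; inj₂; [_,_]′)
import Data.Sum as Sum
open import Data.Vec using ([]; _∷_; tabulate; here; there)
open import Data.Vec.Properties using (lookup∘tabulate; []=⇒lookup; lookup⇒[]=)
open import Data.Vec.Properties.WithK using ([]=-irrelevant)
open import Function.Bundles using (_⇔_; mk⇔; Equivalence)
open import Relation.Binary.Definitions using (tri<; tri≈; tri>)
open import Relation.Binary.PropositionalEquality
  using (_≡_; _≢_; refl; sym; trans; cong; cong₂; subst; subst₂; module ≡-Reasoning)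
open import Relation.Nullary using (Dec; yes; no; does; ¬_; contradiction)
open import Relation.Nullary.Decidable using (isYes≗does; toWitness; fromWitness; map′)

private
  variable
    n : ℕ

m<n∸o⇒o+m<n : ∀ m n o → m < n ∸ o → o + m < n
m<n∸o⇒o+m<n m n       zero    m<n   = m<n
m<n∸o⇒o+m<n m (suc n) (suc o) m<n∸o = s≤s (m<n∸o⇒o+m<n m n o m<n∸o)

∈-tabulate⁺ : {f : Fin n → Bool} {x : Fin n} → T (f x) → x ∈ tabulate f
∈-tabulate⁺ {f = f} {x} t = lookup⇒[]= x (tabulate f) (trans (lookup∘tabulate f x) (Equivalence.to T-≡ t))

∈-tabulate⁻ : {f : Fin n → Bool} {x : Fin n} → x ∈ tabulate f → T (f x)
∈-tabulate⁻ {f = f} {x} x∈ = Equivalence.from T-≡ (trans (sym (lookup∘tabulate f x)) ([]=⇒lookup x∈))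

∈-tabulate-does⁺ : ∀ {p} {A : Fin n → Set p} (d : ∀ x → Dec (A x)) {x : Fin n} →
                   A x → x ∈ tabulate (λ x → does (d x))
∈-tabulate-does⁺ d {x} a = ∈-tabulate⁺ (subst T (isYes≗does (d x)) (fromWitness a))

∈-tabulate-does⁻ : ∀ {p} {A : Fin n → Set p} (d : ∀ x → Dec (A x)) {x : Fin n} →
                   x ∈ tabulate (λ x → does (d x)) → A x
∈-tabulate-does⁻ d {x} x∈ = toWitness (subst T (sym (isYes≗does (d x))) (∈-tabulate⁻ x∈))

tabulate-∧ : (f g : Fin n → Bool) → tabulate (λ x → f x ∧ g x) ≡ tabulate f ∩ tabulate g
tabulate-∧ {zero}  f g = refl
tabulate-∧ {suc n} f g = cong (f zero ∧ g zero ∷_) (tabulate-∧ (λ x → f (suc x)) (λ x → g (suc x)))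

∈-initSeg⁺ : {a : ℕ} {x : Fin n} → toℕ x < a → x ∈ initSeg a
∈-initSeg⁺ x<a = ∈-tabulate⁺ (<⇒<ᵇ x<a)

∈-initSeg⁻ : {a : ℕ} {x : Fin n} → x ∈ initSeg a → toℕ x < a
∈-initSeg⁻ x∈ = <ᵇ⇒< _ _ (∈-tabulate⁻ x∈)

∈-finalSeg⁺ : {β : ℕ} {x : Fin n} → β ≤ toℕ x → x ∈ finalSeg (suc β)
∈-finalSeg⁺ β≤x = ∈-tabulate⁺ (≤⇒≤ᵇ (s≤s β≤x))

∈-finalSeg⁻ : {β : ℕ} {x : Fin n} → x ∈ finalSeg (suc β) → β ≤ toℕ x
∈-finalSeg⁻ x∈ = s≤s⁻¹ (≤ᵇ⇒≤ _ _ (∈-tabulate⁻ x∈))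

interval : ℕ → ℕ → Subset n
interval lo hi = initSeg hi ∩ ∁ (initSeg lo)

∈-interval⁺ : {lo hi : ℕ} {x : Fin n} → lo ≤ toℕ x → toℕ x < hi → x ∈ interval lo hi
∈-interval⁺ lo≤x x<hi = x∈p∩q⁺ (∈-initSeg⁺ x<hi , x∉p⇒x∈∁p (λ x∈ → ≤⇒≯ lo≤x (∈-initSeg⁻ x∈)))

∈-interval⁻ : {lo hi : ℕ} {x : Fin n} → x ∈ interval lo hi → lo ≤ toℕ x × toℕ x < hi
∈-interval⁻ {lo = lo} {hi} x∈ with x∈p∩q⁻ (initSeg hi) (∁ (initSeg lo)) x∈
... | x<hi , x≥lo = ≮⇒≥ (λ x<lo → x∈∁p⇒x∉p x≥lo (∈-initSeg⁺ x<lo)) , ∈-initSeg⁻ x<hi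

∣initSeg∣ : (a : ℕ) → a ≤ n → ∣ initSeg {n} a ∣ ≡ a
∣initSeg∣ {n}     zero    _         = ∣initSeg0∣ n
  where
    ∣initSeg0∣ : ∀ m → ∣ initSeg {m} 0 ∣ ≡ 0
    ∣initSeg0∣ zero    = refl
    ∣initSeg0∣ (suc m) = ∣initSeg0∣ m
∣initSeg∣ {suc n} (suc a) (s≤s a≤n) = cong suc (∣initSeg∣ a a≤n)

∣p∩∁q∣+∣q∣≡∣p∣ : {p q : Subset n} → q ⊆ p → ∣ p ∩ ∁ q ∣ + ∣ q ∣ ≡ ∣ p ∣
∣p∩∁q∣+∣q∣≡∣p∣ {p = []}          {[]}          _   = refl
∣p∩∁q∣+∣q∣≡∣p∣ {p = inside  ∷ p} {inside  ∷ q} q⊆p =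
  trans (+-suc _ _) (cong suc (∣p∩∁q∣+∣q∣≡∣p∣ (drop-∷-⊆ q⊆p)))
∣p∩∁q∣+∣q∣≡∣p∣ {p = inside  ∷ p} {outside ∷ q} q⊆p = cong suc (∣p∩∁q∣+∣q∣≡∣p∣ (drop-∷-⊆ q⊆p))
∣p∩∁q∣+∣q∣≡∣p∣ {p = outside ∷ p} {outside ∷ q} q⊆p = ∣p∩∁q∣+∣q∣≡∣p∣ (drop-∷-⊆ q⊆p)
∣p∩∁q∣+∣q∣≡∣p∣ {p = outside ∷ p} {inside  ∷ q} q⊆p = contradiction (q⊆p here) λ ()

∣interval∣ : (lo hi : ℕ) → hi ≤ n → ∣ interval {n} lo hi ∣ ≡ hi ∸ lo
∣interval∣ {n} lo hi hi≤n with ≤-total lo hi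
... | inj₁ lo≤hi = +-cancelʳ-≡ lo _ _ (trans sizes (sym (m∸n+n≡m lo≤hi)))
  where
    initSeg-mono : initSeg {n} lo ⊆ initSeg hi
    initSeg-mono x∈ = ∈-initSeg⁺ (<-≤-trans (∈-initSeg⁻ x∈) lo≤hi)

    sizes : ∣ interval {n} lo hi ∣ + lo ≡ hi
    sizes = begin
      ∣ interval {n} lo hi ∣ + lo
        ≡⟨ cong (∣ interval {n} lo hi ∣ +_) (∣initSeg∣ lo (≤-trans lo≤hi hi≤n)) ⟨
      ∣ interval {n} lo hi ∣ + ∣ initSeg {n} lo ∣
        ≡⟨ ∣p∩∁q∣+∣q∣≡∣p∣ initSeg-mono ⟩
      ∣ initSeg {n} hi ∣
        ≡⟨ ∣initSeg∣ hi hi≤n ⟩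
      hi ∎
      where open ≡-Reasoning
... | inj₂ hi≤lo = trans (n≤0⇒n≡0 (≤-trans (p⊆q⇒∣p∣≤∣q∣ empty) (≤-reflexive (∣⊥∣≡0 n))))
                         (sym (m≤n⇒m∸n≡0 hi≤lo))
  where
    empty : interval {n} lo hi ⊆ ⊥
    empty x∈ with ∈-interval⁻ x∈
    ... | lo≤x , x<hi = contradiction (<-≤-trans x<hi hi≤lo) (≤⇒≯ lo≤x)

∣p∣≡hi∸lo : {p : Subset n} (lo hi : ℕ) → (∀ {x} → x ∈ p ⇔ (lo ≤ toℕ x × toℕ x < hi)) → hi ≤ n →
            ∣ p ∣ ≡ hi ∸ lo
∣p∣≡hi∸lo {n} {p} lo hi ∈p⇔ hi≤n = trans (cong ∣_∣ p≡interval) (∣interval∣ lo hi hi≤n)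
  where
    p≡interval : p ≡ interval lo hi
    p≡interval = ⊆-antisym
      (λ x∈ → let (lo≤x , x<hi) = Equivalence.to ∈p⇔ x∈ in ∈-interval⁺ {lo = lo} {hi} lo≤x x<hi)
      (λ x∈ → Equivalence.from ∈p⇔ (∈-interval⁻ {lo = lo} {hi} x∈))

∣p∣+∣q∣≡∣p∪q∣+∣p∩q∣ : (p q : Subset n) → ∣ p ∣ + ∣ q ∣ ≡ ∣ p ∪ q ∣ + ∣ p ∩ q ∣
∣p∣+∣q∣≡∣p∪q∣+∣p∩q∣ []            []            = refl
∣p∣+∣q∣≡∣p∪q∣+∣p∩q∣ (inside  ∷ p) (inside  ∷ q) =
  cong suc (trans (+-suc _ _) (trans (cong suc (∣p∣+∣q∣≡∣p∪q∣+∣p∩q∣ p q)) (sym (+-suc _ _))))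
∣p∣+∣q∣≡∣p∪q∣+∣p∩q∣ (inside  ∷ p) (outside ∷ q) = cong suc (∣p∣+∣q∣≡∣p∪q∣+∣p∩q∣ p q)
∣p∣+∣q∣≡∣p∪q∣+∣p∩q∣ (outside ∷ p) (inside  ∷ q) = trans (+-suc _ _) (cong suc (∣p∣+∣q∣≡∣p∪q∣+∣p∩q∣ p q))
∣p∣+∣q∣≡∣p∪q∣+∣p∩q∣ (outside ∷ p) (outside ∷ q) = ∣p∣+∣q∣≡∣p∪q∣+∣p∩q∣ p q

injection⇒∣p∣≤∣q∣ : ∀ {m n} {p : Subset m} {q : Subset n} (f : ∀ x → x ∈ p → Fin n) →
                    (∀ x x∈p → f x x∈p ∈ q) →
                    (∀ {x y} x∈p y∈p → f x x∈p ≡ f y y∈p → x ≡ y) →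
                    ∣ p ∣ ≤ ∣ q ∣
injection⇒∣p∣≤∣q∣ {p = []} f f∈q f-inj = z≤n
injection⇒∣p∣≤∣q∣ {p = outside ∷ p} f f∈q f-inj =
  injection⇒∣p∣≤∣q∣ (λ x x∈p → f (suc x) (there x∈p)) (λ x x∈p → f∈q (suc x) (there x∈p))
    (λ x∈p y∈p eq → suc-injective (f-inj (there x∈p) (there y∈p) eq))
injection⇒∣p∣≤∣q∣ {p = inside ∷ p} {q} f f∈q f-inj = <-≤-trans
  (s≤s (injection⇒∣p∣≤∣q∣ {q = q - f zero here} (λ x x∈p → f (suc x) (there x∈p))
    (λ x x∈p → x∈p∧x≢y⇒x∈p-y (f∈q (suc x) (there x∈p)) (λ eq → 0≢1+n (sym (f-inj (there x∈p) here eq))))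
    (λ x∈p y∈p eq → suc-injective (f-inj (there x∈p) (there y∈p) eq))))
  (x∈p⇒∣p-x∣<∣p∣ (f∈q zero here))

#N-mono : ∀ {n} (X : Path n) {k k′} → k ≤ k′ → #N X k ≤ #N X k′
#N-mono []      _               = z≤n
#N-mono (s ∷ X) {zero}          _         = z≤n
#N-mono (s ∷ X) {suc k} {suc k′} (s≤s k≤k′) = +-monoʳ-≤ (isN s) (#N-mono X k≤k′)

isN≤1 : ∀ s → isN s ≤ 1
isN≤1 N = ≤-refl
isN≤1 E = z≤n

#N≤ : ∀ {n} (X : Path n) k → #N X k ≤ k
#N≤ []      k       = z≤n
#N≤ (s ∷ X) zero    = z≤n
#N≤ (s ∷ X) (suc k) = +-mono-≤ (isN≤1 s) (#N≤ X k)

#N-+ : ∀ {n} (X : Path n) k d → #N X (k + d) ≤ #N X k + d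
#N-+ []      k       d = z≤n
#N-+ (s ∷ X) zero    d = #N≤ (s ∷ X) d
#N-+ (s ∷ X) (suc k) d = ≤-trans (+-monoʳ-≤ (isN s) (#N-+ X k d)) (≤-reflexive (sym (+-assoc (isN s) _ d)))

#N-zero : ∀ {n} (X : Path n) → #N X 0 ≡ 0
#N-zero []      = refl
#N-zero (s ∷ X) = refl

posN<n : ∀ {n} (X : Path n) {i} → i < #N X n → posN X i < n
posN<n (N ∷ X) {zero}  _        = s≤s z≤n
posN<n (N ∷ X) {suc i} (s≤s i<) = s≤s (posN<n X i<)
posN<n (E ∷ X)         i<       = s≤s (posN<n X i<)

#N-posN : ∀ {n} (X : Path n) {i} → i < #N X n → #N X (posN X i) ≡ i
#N-posN (N ∷ X) {zero}  _        = refl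
#N-posN (N ∷ X) {suc i} (s≤s i<) = cong suc (#N-posN X i<)
#N-posN (E ∷ X)         i<       = #N-posN X i<

#N-suc-posN : ∀ {n} (X : Path n) {i} → i < #N X n → #N X (suc (posN X i)) ≡ suc i
#N-suc-posN (N ∷ X) {zero}  _        = cong suc (#N-zero X)
#N-suc-posN (N ∷ X) {suc i} (s≤s i<) = cong suc (#N-suc-posN X i<)
#N-suc-posN (E ∷ X)         i<       = #N-suc-posN X i<

posN<⇒<#N : ∀ {n} (X : Path n) {i k} → i < #N X n → posN X i < k → i < #N X k
posN<⇒<#N X i< posN<k = subst (_≤ #N X _) (#N-suc-posN X i<) (#N-mono X posN<k)

<#N⇒posN< : ∀ {n} (X : Path n) {i k} → i < #N X n → i < #N X k → posN X i < k
<#N⇒posN< X {k = k} i< i<#N = ≰⇒> λ k≤posN →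
  <⇒≱ i<#N (subst (#N X k ≤_) (#N-posN X i<) (#N-mono X k≤posN))

#N≤⇒≤posN : ∀ {n} (X : Path n) {i k} → i < #N X n → #N X k ≤ i → k ≤ posN X i
#N≤⇒≤posN X i< #N≤i = ≮⇒≥ λ posN<k → <⇒≱ (posN<⇒<#N X i< posN<k) #N≤i

≤posN⇒#N≤ : ∀ {n} (X : Path n) {i k} → i < #N X n → k ≤ posN X i → #N X k ≤ i
≤posN⇒#N≤ X i< k≤posN = ≮⇒≥ λ i<#N → ≤⇒≯ k≤posN (<#N⇒posN< X i< i<#N)

posN-strictMono : ∀ {n} (X : Path n) {i i′} → i < i′ → i′ < #N X n → posN X i < posN X i′
posN-strictMono X i<i′ i′< =
  <#N⇒posN< X (<-trans i<i′ i′<) (subst (_ <_) (sym (#N-posN X i′<)) i<i′)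

posN-injective : ∀ {n} (X : Path n) {i i′} → i < #N X n → i′ < #N X n → posN X i ≡ posN X i′ → i ≡ i′
posN-injective X i< i′< eq = trans (sym (#N-posN X i<)) (trans (cong (#N X) eq) (#N-posN X i′<))

module Transversal {n : ℕ} (r : ℕ) (P Q : Path n) where

  ∈-Nset⁺ : {e : Fin n} {i : Fin r} → posN Q (toℕ i) ≤ toℕ e → toℕ e ≤ posN P (toℕ i) → e ∈ Nset r P Q i
  ∈-Nset⁺ l≤e e≤u = ∈-tabulate⁺ (Equivalence.from T-∧ (≤⇒≤ᵇ l≤e , ≤⇒≤ᵇ e≤u))

  ∈-Nset⁻ : {e : Fin n} {i : Fin r} → e ∈ Nset r P Q i → posN Q (toℕ i) ≤ toℕ e × toℕ e ≤ posN P (toℕ i)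
  ∈-Nset⁻ e∈ with Equivalence.to T-∧ (∈-tabulate⁻ e∈)
  ... | l≤e , e≤u = ≤ᵇ⇒≤ _ _ l≤e , ≤ᵇ⇒≤ _ _ e≤u

  meets? : (X : Subset n) (i : Fin r) → Dec (Nonempty (X ∩ Nset r P Q i))
  meets? X i = nonempty? (X ∩ Nset r P Q i)

  meets : Subset n → Subset r
  meets X = tabulate λ i → does (meets? X i)

  ∈-meets⁺ : {X : Subset n} {e : Fin n} {i : Fin r} → e ∈ X → e ∈ Nset r P Q i → i ∈ meets X
  ∈-meets⁺ e∈X e∈N = ∈-tabulate-does⁺ (meets? _) (_ , x∈p∩q⁺ (e∈X , e∈N))

  ∈-meets⁻ : {X : Subset n} {i : Fin r} → i ∈ meets X → ∃[ e ] (e ∈ X × e ∈ Nset r P Q i)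
  ∈-meets⁻ {X} {i} i∈ with ∈-tabulate-does⁻ (meets? X) i∈
  ... | e , e∈ = e , x∈p∩q⁻ X (Nset r P Q i) e∈

  #meeting≡∣meets∩meets∣ : (X Y : Subset n) → #meeting r P Q X Y ≡ ∣ meets X ∩ meets Y ∣
  #meeting≡∣meets∩meets∣ X Y = cong ∣_∣ (tabulate-∧ (λ i → does (meets? X i)) (λ i → does (meets? Y i)))

  isRank-unique : {X : Subset n} {k k′ : ℕ} → IsRank r P Q X k → IsRank r P Q X k′ → k ≡ k′
  isRank-unique ((I , I⊆X , I-ind , ∣I∣≡k) , max) ((I′ , I′⊆X , I′-ind , ∣I′∣≡k′) , max′) =
    ≤-antisym (subst (_≤ _) ∣I∣≡k (max′ I I⊆X I-ind)) (subst (_≤ _) ∣I′∣≡k′ (max I′ I′⊆X I′-ind))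

  isRank⇒≤∣∣ : {X : Subset n} {k : ℕ} → IsRank r P Q X k → k ≤ ∣ X ∣
  isRank⇒≤∣∣ ((I , I⊆X , _ , ∣I∣≡k) , _) = subst (_≤ _) ∣I∣≡k (p⊆q⇒∣p∣≤∣q∣ I⊆X)

  module _ (X : Subset n) (S : Subset r) where

    independent⇒∣I∣≤∣S∣ : (∀ {e i} → e ∈ X → e ∈ Nset r P Q i → i ∈ S) →
                         ∀ {I} → I ⊆ X → Independent r P Q I → ∣ I ∣ ≤ ∣ S ∣
    independent⇒∣I∣≤∣S∣ cover I⊆X (φ , φ∈N , φ-inj) =
      injection⇒∣p∣≤∣q∣ φ (λ e e∈I → cover (I⊆X e∈I) (φ∈N e e∈I)) (φ-inj _ _)

    transversal⇒independent : (rep : ∀ i → i ∈ S → Fin n) →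
      (∀ {i} (i∈S : i ∈ S) → rep i i∈S ∈ X × rep i i∈S ∈ Nset r P Q i) →
      (∀ {i i′} (i∈S : i ∈ S) (i′∈S : i′ ∈ S) → rep i i∈S ≡ rep i′ i′∈S → i ≡ i′) →
      ∃[ I ] (I ⊆ X × Independent r P Q I × ∣ I ∣ ≡ ∣ S ∣)
    transversal⇒independent rep rep∈ rep-inj =
      image , image⊆X , (φ , φ∈N , λ _ _ → φ-inj) ,
      ≤-antisym (injection⇒∣p∣≤∣q∣ φ (λ e e∈ → proj₁ (proj₂ (preimage e∈))) φ-inj)
                (injection⇒∣p∣≤∣q∣ rep (λ i i∈S → rep∈image i∈S) rep-inj)
      where
        rep-cong : ∀ {i i′} → i ≡ i′ → (i∈S : i ∈ S) (i′∈S : i′ ∈ S) → rep i i∈S ≡ rep i′ i′∈S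
        rep-cong refl i∈S i∈S′ = cong (rep _) ([]=-irrelevant i∈S i∈S′)

        hits? : ∀ e i → Dec (Σ (i ∈ S) λ i∈S → rep i i∈S ≡ e)
        hits? e i with i ∈? S
        ... | yes i∈S = map′ (i∈S ,_) (λ (h , eq) → trans (rep-cong refl i∈S h) eq) (rep i i∈S ≟ e)
        ... | no  i∉S = no (λ (i∈S , _) → i∉S i∈S)

        image : Subset n
        image = tabulate λ e → does (any? (hits? e))

        preimage : ∀ {e} → e ∈ image → ∃[ i ] Σ (i ∈ S) λ i∈S → rep i i∈S ≡ e
        preimage e∈ = ∈-tabulate-does⁻ (λ e → any? (hits? e)) e∈

        rep∈image : ∀ {i} (i∈S : i ∈ S) → rep i i∈S ∈ image
        rep∈image i∈S = ∈-tabulate-does⁺ (λ e → any? (hits? e)) (_ , i∈S , refl)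

        image⊆X : image ⊆ X
        image⊆X e∈ with preimage e∈
        ... | i , i∈S , refl = proj₁ (rep∈ i∈S)

        φ : ∀ e → e ∈ image → Fin r
        φ e e∈ = proj₁ (preimage e∈)

        φ∈N : ∀ e (e∈ : e ∈ image) → e ∈ Nset r P Q (φ e e∈)
        φ∈N e e∈ with preimage e∈
        ... | i , i∈S , refl = proj₂ (rep∈ i∈S)

        φ-inj : ∀ {e e′} (e∈ : e ∈ image) (e′∈ : e′ ∈ image) → φ e e∈ ≡ φ e′ e′∈ → e ≡ e′
        φ-inj e∈ e′∈ eq with preimage e∈ | preimage e′∈
        ... | _ , i∈S , refl | _ , i′∈S , refl = rep-cong eq i∈S i′∈S

    isRank-transversal : (∀ {e i} → e ∈ X → e ∈ Nset r P Q i → i ∈ S) →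
      (rep : ∀ i → i ∈ S → Fin n) →
      (∀ {i} (i∈S : i ∈ S) → rep i i∈S ∈ X × rep i i∈S ∈ Nset r P Q i) →
      (∀ {i i′} (i∈S : i ∈ S) (i′∈S : i′ ∈ S) → rep i i∈S ≡ rep i′ i′∈S → i ≡ i′) →
      IsRank r P Q X ∣ S ∣
    isRank-transversal cover rep rep∈ rep-inj =
      transversal⇒independent rep rep∈ rep-inj , λ I I⊆X I-ind → independent⇒∣I∣≤∣S∣ cover I⊆X I-ind

  modularPair⇔isRank-∩ : {X Y : Subset n} {S T : Subset r} →
    IsRank r P Q X ∣ S ∣ → IsRank r P Q Y ∣ T ∣ → IsRank r P Q (X ∪ Y) ∣ S ∪ T ∣ →
    ModularPair r P Q X Y ⇔ IsRank r P Q (X ∩ Y) ∣ S ∩ T ∣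
  modularPair⇔isRank-∩ {X} {Y} {S} {T} rank-X rank-Y rank-X∪Y = mk⇔ to from
    where
      open ≡-Reasoning
      to : ModularPair r P Q X Y → IsRank r P Q (X ∩ Y) ∣ S ∩ T ∣
      to (rX , rY , rU , rI , rank-X′ , rank-Y′ , rank-X∪Y′ , rank-X∩Y , modular) =
        subst (IsRank r P Q (X ∩ Y)) (+-cancelˡ-≡ _ rI _ counting) rank-X∩Y
        where
          counting : ∣ S ∪ T ∣ + rI ≡ ∣ S ∪ T ∣ + ∣ S ∩ T ∣
          counting = begin
            ∣ S ∪ T ∣ + rI         ≡⟨ cong (_+ rI) (isRank-unique rank-X∪Y′ rank-X∪Y) ⟨
            rU + rI                ≡⟨ modular ⟨
            rX + rY                ≡⟨ cong₂ _+_ (isRank-unique rank-X′ rank-X)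
                                                (isRank-unique rank-Y′ rank-Y) ⟩
            ∣ S ∣ + ∣ T ∣          ≡⟨ ∣p∣+∣q∣≡∣p∪q∣+∣p∩q∣ S T ⟩
            ∣ S ∪ T ∣ + ∣ S ∩ T ∣  ∎
      from : IsRank r P Q (X ∩ Y) ∣ S ∩ T ∣ → ModularPair r P Q X Y
      from rank-X∩Y = _ , _ , _ , _ , rank-X , rank-Y , rank-X∪Y , rank-X∩Y , ∣p∣+∣q∣≡∣p∪q∣+∣p∩q∣ S T

module LatticePathMatroid {n r : ℕ} (P Q : Path n) (P-ends : #N P n ≡ r) (Q-ends : #N Q n ≡ r)
                          (P≤Q : NeverAbove P Q) where

  open Transversal r P Q

  P-valid : (i : Fin r) → toℕ i < #N P n
  P-valid i = subst (toℕ i <_) (sym P-ends) (toℕ<n i)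

  Q-valid : (i : Fin r) → toℕ i < #N Q n
  Q-valid i = subst (toℕ i <_) (sym Q-ends) (toℕ<n i)

  l u : Fin r → ℕ
  l i = posN Q (toℕ i)
  u i = posN P (toℕ i)

  l<n : ∀ i → l i < n
  l<n i = posN<n Q (Q-valid i)

  u<n : ∀ i → u i < n
  u<n i = posN<n P (P-valid i)

  l≤u : ∀ i → l i ≤ u i
  l≤u i = #N≤⇒≤posN P (P-valid i)
    (≤-trans (P≤Q (l i) (<⇒≤ (l<n i))) (≤posN⇒#N≤ Q (Q-valid i) ≤-refl))

  lpos upos : Fin r → Fin n
  lpos i = fromℕ< (l<n i)
  upos i = fromℕ< (u<n i)

  fromℕ<∈Nset : ∀ {k} (k<n : k < n) {i} → l i ≤ k → k ≤ u i → fromℕ< k<n ∈ Nset r P Q i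
  fromℕ<∈Nset k<n l≤k k≤u =
    ∈-Nset⁺ (subst (l _ ≤_) (sym (toℕ-fromℕ< k<n)) l≤k) (subst (_≤ u _) (sym (toℕ-fromℕ< k<n)) k≤u)

  lpos∈N : ∀ i → lpos i ∈ Nset r P Q i
  lpos∈N i = fromℕ<∈Nset (l<n i) ≤-refl (l≤u i)

  upos∈N : ∀ i → upos i ∈ Nset r P Q i
  upos∈N i = fromℕ<∈Nset (u<n i) (l≤u i) ≤-refl

  lpos-injective : ∀ {i i′} → lpos i ≡ lpos i′ → i ≡ i′
  lpos-injective eq = toℕ-injective (posN-injective Q (Q-valid _) (Q-valid _) (fromℕ<-injective _ _ _ _ eq))

  upos-injective : ∀ {i i′} → upos i ≡ upos i′ → i ≡ i′
  upos-injective eq = toℕ-injective (posN-injective P (P-valid _) (P-valid _) (fromℕ<-injective _ _ _ _ eq))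

  module _ (a β : ℕ) where

    A B : Subset n
    A = initSeg a
    B = finalSeg (suc β)

    meets-A⁻ : ∀ {i} → i ∈ meets A → l i < a
    meets-A⁻ i∈ with ∈-meets⁻ i∈
    ... | e , e∈A , e∈N = ≤-<-trans (proj₁ (∈-Nset⁻ e∈N)) (∈-initSeg⁻ e∈A)

    meets-B⁻ : ∀ {i} → i ∈ meets B → β ≤ u i
    meets-B⁻ i∈ with ∈-meets⁻ i∈
    ... | e , e∈B , e∈N = ≤-trans (∈-finalSeg⁻ e∈B) (proj₂ (∈-Nset⁻ e∈N))

    lpos∈A : ∀ {i} → l i < a → lpos i ∈ A
    lpos∈A l<a = ∈-initSeg⁺ (subst (_< a) (sym (toℕ-fromℕ< _)) l<a)

    upos∈B : ∀ {i} → β ≤ u i → upos i ∈ B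
    upos∈B β≤u = ∈-finalSeg⁺ (subst (β ≤_) (sym (toℕ-fromℕ< _)) β≤u)

    meets-A⁺ : ∀ {i} → l i < a → i ∈ meets A
    meets-A⁺ l<a = ∈-meets⁺ (lpos∈A l<a) (lpos∈N _)

    meets-B⁺ : ∀ {i} → β ≤ u i → i ∈ meets B
    meets-B⁺ β≤u = ∈-meets⁺ (upos∈B β≤u) (upos∈N _)

    rank-A : IsRank r P Q A ∣ meets A ∣
    rank-A = isRank-transversal A (meets A) ∈-meets⁺ (λ i _ → lpos i)
      (λ i∈ → lpos∈A (meets-A⁻ i∈) , lpos∈N _) (λ _ _ → lpos-injective)

    rank-B : IsRank r P Q B ∣ meets B ∣
    rank-B = isRank-transversal B (meets B) ∈-meets⁺ (λ i _ → upos i)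
      (λ i∈ → upos∈B (meets-B⁻ i∈) , upos∈N _) (λ _ _ → upos-injective)

    rank-A∪B : IsRank r P Q (A ∪ B) ∣ meets A ∪ meets B ∣
    rank-A∪B =
      isRank-transversal (A ∪ B) (meets A ∪ meets B) cover (λ i _ → rep i) rep∈ (λ _ _ → rep-injective)
      where
        cover : ∀ {e i} → e ∈ A ∪ B → e ∈ Nset r P Q i → i ∈ meets A ∪ meets B
        cover e∈ e∈N =
          x∈p∪q⁺ (Sum.map (λ e∈A → ∈-meets⁺ e∈A e∈N) (λ e∈B → ∈-meets⁺ e∈B e∈N) (x∈p∪q⁻ A B e∈))

        rep : Fin r → Fin n
        rep i with l i <? a
        ... | yes _ = lpos i
        ... | no  _ = upos i

        rep∈ : ∀ {i} → i ∈ meets A ∪ meets B → rep i ∈ A ∪ B × rep i ∈ Nset r P Q i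
        rep∈ {i} i∈ with l i <? a
        ... | yes l<a = x∈p∪q⁺ (inj₁ (lpos∈A l<a)) , lpos∈N i
        ... | no  l≮a = x∈p∪q⁺ (inj₂ (upos∈B β≤u)) , upos∈N i
          where
            β≤u : β ≤ u i
            β≤u = [ (λ i∈A → contradiction (meets-A⁻ i∈A) l≮a) , meets-B⁻ ]′ (x∈p∪q⁻ (meets A) (meets B) i∈)

        lpos≢upos : ∀ {i i′} → l i < a → ¬ l i′ < a → lpos i ≢ upos i′
        lpos≢upos l<a l′≮a eq =
          <⇒≢ (<-≤-trans l<a (≤-trans (≮⇒≥ l′≮a) (l≤u _))) (fromℕ<-injective _ _ _ _ eq)

        rep-injective : ∀ {i i′} → rep i ≡ rep i′ → i ≡ i′
        rep-injective {i} {i′} eq with l i <? a | l i′ <? a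
        ... | yes _   | yes _    = lpos-injective eq
        ... | no  _   | no  _    = upos-injective eq
        ... | yes l<a | no  l′≮a = contradiction eq (lpos≢upos l<a l′≮a)
        ... | no  l≮a | yes l′<a = contradiction (sym eq) (lpos≢upos l′<a l≮a)

    ∈-meets-A∩meets-B⇔ : ∀ {i} → i ∈ meets A ∩ meets B ⇔ (#N P β ≤ toℕ i × toℕ i < #N Q a)
    ∈-meets-A∩meets-B⇔ {i} = mk⇔
      (λ i∈ → let (i∈A , i∈B) = x∈p∩q⁻ (meets A) (meets B) i∈ in
        ≤posN⇒#N≤ P (P-valid i) (meets-B⁻ i∈B) , posN<⇒<#N Q (Q-valid i) (meets-A⁻ i∈A))
      (λ (k≤i , i<j) →
        x∈p∩q⁺ (meets-A⁺ (<#N⇒posN< Q (Q-valid i) i<j) , meets-B⁺ (#N≤⇒≤posN P (P-valid i) k≤i)))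

    ∈-A∩B⇔ : ∀ {e} → e ∈ A ∩ B ⇔ (β ≤ toℕ e × toℕ e < a)
    ∈-A∩B⇔ = mk⇔ (λ e∈ → let (e∈A , e∈B) = x∈p∩q⁻ A B e∈ in ∈-finalSeg⁻ e∈B , ∈-initSeg⁻ e∈A)
                 (λ (β≤e , e<a) → x∈p∩q⁺ (∈-initSeg⁺ e<a , ∈-finalSeg⁺ β≤e))

    -- Greedy matching: the blocks meeting both A and B take, in order, the consecutive elements
    -- β, β + 1, … of A ∩ B = [β, a), except that a block starting further right takes its left end.
    position : Fin r → ℕ
    position i = l i ⊔ (β + (toℕ i ∸ #N P β))

    position-between : ∀ {i} → i ∈ meets A ∩ meets B → l i ≤ position i × position i ≤ u i
    position-between {i} i∈ = let (k≤i , _) = Equivalence.to ∈-meets-A∩meets-B⇔ i∈ in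
      m≤m⊔n _ _ ,
      ⊔-lub (l≤u i) (#N≤⇒≤posN P (P-valid i) (≤-trans (#N-+ P β _) (≤-reflexive (m+[n∸m]≡n k≤i))))

    position-strictMono : ∀ {i i′} → i ∈ meets A ∩ meets B → toℕ i < toℕ i′ → position i < position i′
    position-strictMono i∈ i<i′ = ⊔-mono-< (posN-strictMono Q i<i′ (Q-valid _))
      (+-monoʳ-< β (∸-monoˡ-< i<i′ (proj₁ (Equivalence.to ∈-meets-A∩meets-B⇔ i∈))))

    position-injective : ∀ {i i′} → i ∈ meets A ∩ meets B → i′ ∈ meets A ∩ meets B →
                         position i ≡ position i′ → i ≡ i′
    position-injective {i} {i′} i∈ i′∈ eq with <-cmp (toℕ i) (toℕ i′)
    ... | tri< i<i′ _ _ = contradiction eq (<⇒≢ (position-strictMono i∈ i<i′))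
    ... | tri≈ _ i≡i′ _ = toℕ-injective i≡i′
    ... | tri> _ _ i′<i = contradiction (sym eq) (<⇒≢ (position-strictMono i′∈ i′<i))

    position<a : #N Q a ∸ #N P β ≤ a ∸ β → ∀ {i} → i ∈ meets A ∩ meets B → position i < a
    position<a fits i∈ = let (k≤i , i<j) = Equivalence.to ∈-meets-A∩meets-B⇔ i∈ in
      ⊔-pres-<m (meets-A⁻ (proj₁ (x∈p∩q⁻ (meets A) (meets B) i∈)))
                (m<n∸o⇒o+m<n _ a β (<-≤-trans (∸-monoˡ-< i<j k≤i) fits))

    rank-A∩B : a ≤ n → #N Q a ∸ #N P β ≤ a ∸ β → IsRank r P Q (A ∩ B) ∣ meets A ∩ meets B ∣
    rank-A∩B a≤n fits = isRank-transversal (A ∩ B) (meets A ∩ meets B) cover rep rep∈ rep-injective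
      where
        cover : ∀ {e i} → e ∈ A ∩ B → e ∈ Nset r P Q i → i ∈ meets A ∩ meets B
        cover e∈ e∈N = let (e∈A , e∈B) = x∈p∩q⁻ A B e∈ in x∈p∩q⁺ (∈-meets⁺ e∈A e∈N , ∈-meets⁺ e∈B e∈N)

        rep<n : ∀ {i} → i ∈ meets A ∩ meets B → position i < n
        rep<n i∈ = <-≤-trans (position<a fits i∈) a≤n

        rep : ∀ i → i ∈ meets A ∩ meets B → Fin n
        rep i i∈ = fromℕ< (rep<n i∈)

        rep∈ : ∀ {i} (i∈ : i ∈ meets A ∩ meets B) → rep i i∈ ∈ A ∩ B × rep i i∈ ∈ Nset r P Q i
        rep∈ i∈ =
          x∈p∩q⁺ (∈-initSeg⁺ (subst (_< a) (sym (toℕ-fromℕ< _)) (position<a fits i∈)) ,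
                  ∈-finalSeg⁺ (subst (β ≤_) (sym (toℕ-fromℕ< _)) (≤-trans (m≤m+n β _) (m≤n⊔m _ _)))) ,
          fromℕ<∈Nset (rep<n i∈) (proj₁ (position-between i∈)) (proj₂ (position-between i∈))

        rep-injective : ∀ {i i′} (i∈ : i ∈ meets A ∩ meets B) (i′∈ : i′ ∈ meets A ∩ meets B) →
                        rep i i∈ ≡ rep i′ i′∈ → i ≡ i′
        rep-injective i∈ i′∈ eq = position-injective i∈ i′∈ (fromℕ<-injective _ _ _ _ eq)

    modularPair⇔#meeting≤∣A∩B∣ : a ≤ n → ModularPair r P Q A B ⇔ (#meeting r P Q A B ≤ ∣ A ∩ B ∣)
    modularPair⇔#meeting≤∣A∩B∣ a≤n = mk⇔
      (λ modular → subst (_≤ ∣ A ∩ B ∣) (sym (#meeting≡∣meets∩meets∣ A B))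
                     (isRank⇒≤∣∣ (Equivalence.to modular⇔rank-A∩B modular)))
      (λ fits → Equivalence.from modular⇔rank-A∩B (rank-A∩B a≤n (subst₂ _≤_
         (trans (#meeting≡∣meets∩meets∣ A B) (∣p∣≡hi∸lo _ _ ∈-meets-A∩meets-B⇔ j≤r))
         (∣p∣≡hi∸lo β a ∈-A∩B⇔ a≤n)
         fits)))
      where
        j≤r : #N Q a ≤ r
        j≤r = subst (#N Q a ≤_) Q-ends (#N-mono Q a≤n)

        modular⇔rank-A∩B : ModularPair r P Q A B ⇔ IsRank r P Q (A ∩ B) ∣ meets A ∩ meets B ∣
        modular⇔rank-A∩B = modularPair⇔isRank-∩ {S = meets A} {meets B} rank-A rank-B rank-A∪B

lemma4p1 : (m r : ℕ) (P Q : Path (m + r)) →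
    EndsAt m r P → EndsAt m r Q → NeverAbove P Q → MeetOnlyAtEnds P Q →
    (a b : ℕ) → IsInitialConnectedFlat Q a → IsFinalConnectedFlat P b →
    ModularPair r P Q (initSeg a) (finalSeg b)
      ⇔ (#meeting r P Q (initSeg a) (finalSeg b) ≤ ∣ initSeg {m + r} a ∩ finalSeg b ∣)
lemma4p1 m r P Q P-ends Q-ends P≤Q _ a b (_ , (a′ , refl , _)) (_ , (β , refl , _))
  rewrite +-comm (toℕ β) 1 =
  LatticePathMatroid.modularPair⇔#meeting≤∣A∩B∣ P Q P-ends Q-ends P≤Q (toℕ a′) (toℕ β) (<⇒≤ (toℕ<n a′))
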